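{- For every integer $n\ge 2$, the Turán graph $T(n,2)$ is a $G$-graph.
   Context: For integers $1\le r\le n$, the Turán graph $T(n,r)$ is the complete $r$-partite simple graph on $n$ vertices whose parts have sizes $\lceil n/r\rceil$ or $\lfloor n/r\rfloor$; two vertices are adjacent iff they lie in different parts. In particular $T(n,2)=K_{\lceil n/2\rceil,\lfloor n/2\rfloor}$. For a group $G$ and a finite family $S=\{s_1,\dots,s_k\}$ of elements generating $G$ (repetitions allowed), the $G$-graph $\Gamma(G,S)$ is the loopless multigraph with vertex set the disjoint union of the sets $V_{s_i}$ of right cosets $\langle s_i\rangle x$ ($x\in G$), where for $i\ne j$, $\langle s_i\rangle x$ and $\langle s_j\rangle y$ are joined by exactly $|\langle s_i\rangle x\cap\langle s_j\rangle y|$ parallel edges and vertices in the same $V_{s_i}$ are non-adjacent. A graph is a $G$-graph if it is isomorphic to $\Gamma(G,S)$ for some group $G$ and some finite generating (multi)set $S$. -}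

module Defs where

open import Level using (Level; 0ℓ)
open import Data.Nat using (ℕ; NonZero)
open import Data.Nat.DivMod using (_%_)
open import Data.Fin using (Fin; toℕ)
open import Data.Product using (Σ; _×_; _,_; ∃)
open import Relation.Nullary using (¬_)
open import Relation.Binary.PropositionalEquality using (_≡_; _≢_)
open import Algebra.Bundles using (Group)
open import Function.Bundles using (_⇔_)

-- Turán graph T(n,r) on vertex set Fin n: vertex v lies in part (toℕ v mod r);
-- these r parts have sizes ⌈n/r⌉ or ⌊n/r⌋.  Two vertices are adjacent iff
-- they lie in different parts.
TuranAdj : (n r : ℕ) → .{{NonZero r}} → Fin n → Fin n → Set
TuranAdj n r u v = toℕ u % r ≢ toℕ v % r

module GroupDefs (G : Group 0ℓ 0ℓ) where
  open Group G

  data InSpan {k : ℕ} (S : Fin k → Carrier) : Carrier → Set where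
    gen  : (i : Fin k) → InSpan S (S i)
    unit : InSpan S ε
    mul  : ∀ {g h} → InSpan S g → InSpan S h → InSpan S (g ∙ h)
    inv  : ∀ {g} → InSpan S g → InSpan S (g ⁻¹)
    resp : ∀ {g h} → g ≈ h → InSpan S g → InSpan S h

  Generates : {k : ℕ} → (Fin k → Carrier) → Set
  Generates S = ∀ g → InSpan S g

  InCyclic : Carrier → Carrier → Set
  InCyclic s = InSpan {1} (λ _ → s)

  InCoset : Carrier → Carrier → Carrier → Set
  InCoset s x g = Σ Carrier λ h → InCyclic s h × (g ≈ h ∙ x)

  SameCoset : Carrier → Carrier → Carrier → Carrier → Set
  SameCoset s x t y = ∀ g → InCoset s x g ⇔ InCoset t y g

  ExactlyOne : (Carrier → Set) → Set
  ExactlyOne P = Σ Carrier λ g → P g × (∀ h → P h → h ≈ g)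

  Empty : (Carrier → Set) → Set
  Empty P = ∀ g → ¬ P g

  -- Γ(G,S) is isomorphic to the simple graph (Fin n, Adj), witnessed by a map f
  -- from representatives (i , x) of vertices ⟨s_i⟩x of Γ(G,S) onto Fin n which
  -- identifies exactly the representatives of the same vertex, and such that
  -- the number of parallel edges |⟨s_i⟩x ∩ ⟨s_j⟩y| (i ≠ j; 0 if i = j) between
  -- two vertices equals 1 if their images are adjacent and 0 otherwise.
  record IsoGGraph {k : ℕ} (S : Fin k → Carrier) (n : ℕ)
                   (Adj : Fin n → Fin n → Set) : Set where
    field
      f          : Fin k → Carrier → Fin n
      surjective : ∀ v → Σ (Fin k) λ i → Σ Carrier λ x → f i x ≡ v
      sameVertex : ∀ i j x y →
                   (f i x ≡ f j y) ⇔ (Σ (i ≡ j) λ _ → SameCoset (S i) x (S j) y)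
      adjacent   : ∀ i j x y → Adj (f i x) (f j y) →
                   (i ≢ j) × ExactlyOne (λ g → InCoset (S i) x g × InCoset (S j) y g)
      nonAdjacent : ∀ i j x y → ¬ Adj (f i x) (f j y) → i ≢ j →
                   Empty (λ g → InCoset (S i) x g × InCoset (S j) y g)

IsGGraph : (n : ℕ) → (Fin n → Fin n → Set) → Set₁
IsGGraph n Adj =
  Σ (Group 0ℓ 0ℓ) λ G → let open Group G; open GroupDefs G in
    Σ ℕ λ k → Σ (Fin k → Carrier) λ S → Generates S × IsoGGraph S n Adj

-- In C_a × C_b with generators s₀ = (1, g) and s₁ = (g, 1) (g a generator of the relevant
-- factor), the cosets of ⟨s₀⟩ are the fibres of the first projection and those of ⟨s₁⟩ the
-- fibres of the second, so a coset of each kind meets one of the other kind in exactly one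
-- element. Hence Γ(C_a × C_b, {s₀, s₁}) = K_{a,b}, and T(n,2) = K_{⌈n/2⌉,⌊n/2⌋}.
module Submission where

open import Level using (0ℓ)
open import Data.Nat
  using (ℕ; zero; suc; _+_; _*_; _∸_; _<_; _≥_; s≤s; z<s; s<s; NonZero; ⌊_/2⌋; ⌈_/2⌉; >-nonZero⁻¹)
open import Data.Nat.Properties
  using (+-assoc; +-identityʳ; +-comm; m∸n+n≡m; <⇒≤; *-cancelʳ-≡; suc-injective; 0≢1+n)
open import Data.Nat.DivMod
  using (_%_; %-distribˡ-+; m%n%n≡m%n; n%n≡0; m<n⇒m%n≡m; m%n<n; m*n%n≡0; [m+kn]%n≡m%n)
open import Data.Fin using (Fin; zero; suc; toℕ; fromℕ<)
open import Data.Fin.Properties using (toℕ-fromℕ<; toℕ-injective; toℕ<n; fromℕ<-cong; fromℕ<-injective)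
open import Data.Product using (Σ; ∃; _×_; _,_; proj₁; proj₂)
open import Data.Sum using (_⊎_; inj₁; inj₂)
open import Data.Empty using (⊥-elim)
open import Function using (_∘_)
open import Function.Bundles using (_⇔_; mk⇔; Equivalence)
open import Relation.Nullary using (¬_)
open import Relation.Binary.Bundles using (Setoid)
open import Relation.Binary.PropositionalEquality
  using (_≡_; _≢_; refl; sym; trans; cong; cong₂; subst; module ≡-Reasoning)
open import Algebra.Bundles using (Group)
import Algebra.Construct.DirectProduct as DirectProduct
open import Algebra.Properties.Group using (ε⁻¹≈ε; //-rightDividesˡ)
open import Defs

open Equivalence using (to; from)

module ℤmod (m : ℕ) .{{_ : NonZero m}} where

  _≈_ : ℕ → ℕ → Set
  x ≈ y = x % m ≡ y % m

  _⁻¹ : ℕ → ℕ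
  x ⁻¹ = m ∸ x % m

  +-cong : ∀ {x y u v} → x ≈ y → u ≈ v → (x + u) ≈ (y + v)
  +-cong {x} {y} {u} {v} x≈y u≈v = begin
    (x + u) % m              ≡⟨ %-distribˡ-+ x u m ⟩
    (x % m + u % m) % m      ≡⟨ cong₂ (λ p q → (p + q) % m) x≈y u≈v ⟩
    (y % m + v % m) % m      ≡⟨ %-distribˡ-+ y v m ⟨
    (y + v) % m              ∎
    where open ≡-Reasoning

  ⁻¹-inverseˡ : ∀ x → (x ⁻¹ + x) ≈ 0
  ⁻¹-inverseˡ x = begin
    (x ⁻¹ + x) % m           ≡⟨ +-cong {x ⁻¹} refl (sym (m%n%n≡m%n x m)) ⟩
    (m ∸ x % m + x % m) % m  ≡⟨ cong (_% m) (m∸n+n≡m (<⇒≤ (m%n<n x m))) ⟩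
    m % m                    ≡⟨ n%n≡0 m ⟩
    0                        ≡⟨ m<n⇒m%n≡m (>-nonZero⁻¹ m) ⟨
    0 % m                    ∎
    where open ≡-Reasoning

  group : Group 0ℓ 0ℓ
  group = record
    { Carrier = ℕ ; _≈_ = _≈_ ; _∙_ = _+_ ; ε = 0 ; _⁻¹ = _⁻¹
    ; isGroup = record
      { isMonoid = record
        { isSemigroup = record
          { isMagma = record
            { isEquivalence = record { refl = refl ; sym = sym ; trans = trans }
            ; ∙-cong = +-cong }
          ; assoc = λ x y z → cong (_% m) (+-assoc x y z) }
        ; identity = (λ _ → refl) , (λ x → cong (_% m) (+-identityʳ x)) }
      ; inverse = ⁻¹-inverseˡ
                , (λ x → trans (cong (_% m) (+-comm x (x ⁻¹))) (⁻¹-inverseˡ x))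
      ; ⁻¹-cong = cong (λ r → (m ∸ r) % m)
      }
    }

  1-generates : ∀ x → GroupDefs.InCyclic group 1 x
  1-generates zero    = GroupDefs.unit
  1-generates (suc x) = GroupDefs.mul (GroupDefs.gen zero) (1-generates x)

record IsCompleteBipartite (n : ℕ) (Adj : Fin n → Fin n → Set) (X Y : Setoid 0ℓ 0ℓ) : Set where
  field
    left                    : Setoid.Carrier X → Fin n
    right                   : Setoid.Carrier Y → Fin n
    left-≡⇔≈                : ∀ x x′ → (left x ≡ left x′) ⇔ Setoid._≈_ X x x′
    right-≡⇔≈               : ∀ y y′ → (right y ≡ right y′) ⇔ Setoid._≈_ Y y y′
    covers                  : ∀ v → (∃ λ x → left x ≡ v) ⊎ (∃ λ y → right y ≡ v)
    left-right-adjacent     : ∀ x y → Adj (left x) (right y)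
    right-left-adjacent     : ∀ x y → Adj (right y) (left x)
    left-left-nonadjacent   : ∀ x x′ → ¬ Adj (left x) (left x′)
    right-right-nonadjacent : ∀ y y′ → ¬ Adj (right y) (right y′)

  left≢right : ∀ x y → left x ≢ right y
  left≢right x y eq =
    right-right-nonadjacent y y (subst (λ v → Adj v (right y)) eq (left-right-adjacent x y))

module CyclicProduct (A B : Group 0ℓ 0ℓ) (α : Group.Carrier A) (β : Group.Carrier B)
                     (α-generates : ∀ x → GroupDefs.InCyclic A α x)
                     (β-generates : ∀ y → GroupDefs.InCyclic B β y) where

  private
    module A = Group A
    module B = Group B
    module DefsA = GroupDefs A
    module DefsB = GroupDefs B

  G : Group 0ℓ 0ℓ
  G = DirectProduct.group A B

  open Group G using (Carrier)
  open GroupDefs G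

  s₀ s₁ : Carrier
  s₀ = A.ε , β
  s₁ = α , B.ε

  S : Fin 2 → Carrier
  S zero       = s₀
  S (suc zero) = s₁

  ε,-inSpan : ∀ {k} {T : Fin k → Carrier} {y} →
              InSpan T s₀ → DefsB.InCyclic β y → InSpan T (A.ε , y)
  ε,-inSpan t (DefsB.gen _)    = t
  ε,-inSpan t DefsB.unit       = unit
  ε,-inSpan t (DefsB.mul p q)  = resp (A.identityˡ A.ε , B.refl) (mul (ε,-inSpan t p) (ε,-inSpan t q))
  ε,-inSpan t (DefsB.inv p)    = resp (ε⁻¹≈ε A , B.refl) (inv (ε,-inSpan t p))
  ε,-inSpan t (DefsB.resp e p) = resp (A.refl , e) (ε,-inSpan t p)

  ,ε-inSpan : ∀ {k} {T : Fin k → Carrier} {x} →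
              InSpan T s₁ → DefsA.InCyclic α x → InSpan T (x , B.ε)
  ,ε-inSpan t (DefsA.gen _)    = t
  ,ε-inSpan t DefsA.unit       = unit
  ,ε-inSpan t (DefsA.mul p q)  = resp (A.refl , B.identityˡ B.ε) (mul (,ε-inSpan t p) (,ε-inSpan t q))
  ,ε-inSpan t (DefsA.inv p)    = resp (A.refl , ε⁻¹≈ε B) (inv (,ε-inSpan t p))
  ,ε-inSpan t (DefsA.resp e p) = resp (e , B.refl) (,ε-inSpan t p)

  proj₁-cyclic : ∀ {s g} → proj₁ s A.≈ A.ε → InCyclic s g → proj₁ g A.≈ A.ε
  proj₁-cyclic s≈ε (gen _)    = s≈ε
  proj₁-cyclic s≈ε unit       = A.refl
  proj₁-cyclic s≈ε (mul p q)  =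
    A.trans (A.∙-cong (proj₁-cyclic s≈ε p) (proj₁-cyclic s≈ε q)) (A.identityˡ A.ε)
  proj₁-cyclic s≈ε (inv p)    = A.trans (A.⁻¹-cong (proj₁-cyclic s≈ε p)) (ε⁻¹≈ε A)
  proj₁-cyclic s≈ε (resp e p) = A.trans (A.sym (proj₁ e)) (proj₁-cyclic s≈ε p)

  proj₂-cyclic : ∀ {s g} → proj₂ s B.≈ B.ε → InCyclic s g → proj₂ g B.≈ B.ε
  proj₂-cyclic s≈ε (gen _)    = s≈ε
  proj₂-cyclic s≈ε unit       = B.refl
  proj₂-cyclic s≈ε (mul p q)  =
    B.trans (B.∙-cong (proj₂-cyclic s≈ε p) (proj₂-cyclic s≈ε q)) (B.identityˡ B.ε)
  proj₂-cyclic s≈ε (inv p)    = B.trans (B.⁻¹-cong (proj₂-cyclic s≈ε p)) (ε⁻¹≈ε B)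
  proj₂-cyclic s≈ε (resp e p) = B.trans (B.sym (proj₂ e)) (proj₂-cyclic s≈ε p)

  coset₀⇔ : ∀ x g → InCoset s₀ x g ⇔ proj₁ g A.≈ proj₁ x
  coset₀⇔ (x₁ , x₂) (g₁ , g₂) = mk⇔
    (λ (h , h∈ , g≈hx) →
       A.trans (proj₁ g≈hx) (A.trans (A.∙-congʳ (proj₁-cyclic A.refl h∈)) (A.identityˡ x₁)))
    (λ g₁≈x₁ → (A.ε , g₂ B.// x₂) , ε,-inSpan (gen zero) (β-generates _)
             , A.trans g₁≈x₁ (A.sym (A.identityˡ x₁)) , B.sym (//-rightDividesˡ B x₂ g₂))

  coset₁⇔ : ∀ y g → InCoset s₁ y g ⇔ proj₂ g B.≈ proj₂ y
  coset₁⇔ (y₁ , y₂) (g₁ , g₂) = mk⇔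
    (λ (h , h∈ , g≈hy) →
       B.trans (proj₂ g≈hy) (B.trans (B.∙-congʳ (proj₂-cyclic B.refl h∈)) (B.identityˡ y₂)))
    (λ g₂≈y₂ → (g₁ A.// y₁ , B.ε) , ,ε-inSpan (gen zero) (α-generates _)
             , A.sym (//-rightDividesˡ A y₁ g₁) , B.trans g₂≈y₂ (B.sym (B.identityˡ y₂)))

  sameCoset₀⇔ : ∀ x y → SameCoset s₀ x s₀ y ⇔ proj₁ x A.≈ proj₁ y
  sameCoset₀⇔ x y = mk⇔
    (λ same → to (coset₀⇔ y x) (to (same x) (from (coset₀⇔ x x) A.refl)))
    (λ x≈y g → mk⇔ (λ c → from (coset₀⇔ y g) (A.trans (to (coset₀⇔ x g) c) x≈y))
                   (λ c → from (coset₀⇔ x g) (A.trans (to (coset₀⇔ y g) c) (A.sym x≈y))))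

  sameCoset₁⇔ : ∀ x y → SameCoset s₁ x s₁ y ⇔ proj₂ x B.≈ proj₂ y
  sameCoset₁⇔ x y = mk⇔
    (λ same → to (coset₁⇔ y x) (to (same x) (from (coset₁⇔ x x) B.refl)))
    (λ x≈y g → mk⇔ (λ c → from (coset₁⇔ y g) (B.trans (to (coset₁⇔ x g) c) x≈y))
                   (λ c → from (coset₁⇔ x g) (B.trans (to (coset₁⇔ y g) c) (B.sym x≈y))))

  cosets-meet-once : ∀ x y → ExactlyOne (λ g → InCoset s₀ x g × InCoset s₁ y g)
  cosets-meet-once x y =
      (proj₁ x , proj₂ y)
    , (from (coset₀⇔ x _) A.refl , from (coset₁⇔ y _) B.refl)
    , λ h (h∈x , h∈y) → to (coset₀⇔ x h) h∈x , to (coset₁⇔ y h) h∈y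

  S-generates : Generates S
  S-generates (p , q) = resp (A.identityʳ p , B.identityˡ q)
    (mul (,ε-inSpan (gen (suc zero)) (α-generates p)) (ε,-inSpan (gen zero) (β-generates q)))

  module _ {n Adj} (K : IsCompleteBipartite n Adj A.setoid B.setoid) where
    open IsCompleteBipartite K

    vertex : Fin 2 → Carrier → Fin n
    vertex zero       (x , _) = left x
    vertex (suc zero) (_ , y) = right y

    vertex-surjective : ∀ v → Σ (Fin 2) λ i → Σ Carrier λ x → vertex i x ≡ v
    vertex-surjective v with covers v
    ... | inj₁ (x , eq) = zero , (x , B.ε) , eq
    ... | inj₂ (y , eq) = suc zero , (A.ε , y) , eq

    vertex-≡⇔sameCoset : ∀ i j x y →
      (vertex i x ≡ vertex j y) ⇔ (Σ (i ≡ j) λ _ → SameCoset (S i) x (S j) y)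
    vertex-≡⇔sameCoset zero zero x y = mk⇔
      (λ eq → refl , from (sameCoset₀⇔ x y) (to (left-≡⇔≈ _ _) eq))
      (λ (_ , same) → from (left-≡⇔≈ _ _) (to (sameCoset₀⇔ x y) same))
    vertex-≡⇔sameCoset (suc zero) (suc zero) x y = mk⇔
      (λ eq → refl , from (sameCoset₁⇔ x y) (to (right-≡⇔≈ _ _) eq))
      (λ (_ , same) → from (right-≡⇔≈ _ _) (to (sameCoset₁⇔ x y) same))
    vertex-≡⇔sameCoset zero (suc zero) x y =
      mk⇔ (⊥-elim ∘ left≢right _ _) (λ ())
    vertex-≡⇔sameCoset (suc zero) zero x y =
      mk⇔ (⊥-elim ∘ left≢right _ _ ∘ sym) (λ ())

    vertex-adjacent : ∀ i j x y → Adj (vertex i x) (vertex j y) →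
      (i ≢ j) × ExactlyOne (λ g → InCoset (S i) x g × InCoset (S j) y g)
    vertex-adjacent zero       zero       x y adj = ⊥-elim (left-left-nonadjacent _ _ adj)
    vertex-adjacent (suc zero) (suc zero) x y adj = ⊥-elim (right-right-nonadjacent _ _ adj)
    vertex-adjacent zero       (suc zero) x y _   = (λ ()) , cosets-meet-once x y
    vertex-adjacent (suc zero) zero       x y _   =
      let g , (g∈y , g∈x) , unique = cosets-meet-once y x
      in (λ ()) , g , (g∈x , g∈y) , λ h (h∈x , h∈y) → unique h (h∈y , h∈x)

    vertex-nonAdjacent : ∀ i j x y → ¬ Adj (vertex i x) (vertex j y) → i ≢ j →
      Empty (λ g → InCoset (S i) x g × InCoset (S j) y g)
    vertex-nonAdjacent zero       zero       x y _    i≢j = ⊥-elim (i≢j refl)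
    vertex-nonAdjacent (suc zero) (suc zero) x y _    i≢j = ⊥-elim (i≢j refl)
    vertex-nonAdjacent zero       (suc zero) x y ¬adj _   = ⊥-elim (¬adj (left-right-adjacent _ _))
    vertex-nonAdjacent (suc zero) zero       x y ¬adj _   = ⊥-elim (¬adj (right-left-adjacent _ _))

    completeBipartite-isGGraph : IsGGraph n Adj
    completeBipartite-isGGraph = G , 2 , S , S-generates , record
      { f           = vertex
      ; surjective  = vertex-surjective
      ; sameVertex  = vertex-≡⇔sameCoset
      ; adjacent    = vertex-adjacent
      ; nonAdjacent = vertex-nonAdjacent
      }

m<⌈n/2⌉⇒m*2<n : ∀ {m} n → m < ⌈ n /2⌉ → m * 2 < n
m<⌈n/2⌉⇒m*2<n {zero}  (suc n)       _         = z<s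
m<⌈n/2⌉⇒m*2<n {suc m} (suc (suc n)) (s<s m<⌈n/2⌉) = s<s (s<s (m<⌈n/2⌉⇒m*2<n n m<⌈n/2⌉))

m<⌊n/2⌋⇒1+m*2<n : ∀ {m} n → m < ⌊ n /2⌋ → suc (m * 2) < n
m<⌊n/2⌋⇒1+m*2<n {zero}  (suc (suc n)) _         = s<s z<s
m<⌊n/2⌋⇒1+m*2<n {suc m} (suc (suc n)) (s<s m<⌊n/2⌋) = s<s (s<s (m<⌊n/2⌋⇒1+m*2<n n m<⌊n/2⌋))

k<n⇒even⊎odd : ∀ {k n} → k < n →
  (∃ λ r → r < ⌈ n /2⌉ × r * 2 ≡ k) ⊎ (∃ λ r → r < ⌊ n /2⌋ × suc (r * 2) ≡ k)
k<n⇒even⊎odd {zero}        {suc n}       _ = inj₁ (0 , z<s , refl)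
k<n⇒even⊎odd {suc zero}    {suc zero}    (s<s ())
k<n⇒even⊎odd {suc zero}    {suc (suc n)} _ = inj₂ (0 , z<s , refl)
k<n⇒even⊎odd {suc (suc k)} {suc (suc n)} (s<s (s<s k<n)) with k<n⇒even⊎odd k<n
... | inj₁ (r , r< , eq) = inj₁ (suc r , s<s r< , cong (λ k → suc (suc k)) eq)
... | inj₂ (r , r< , eq) = inj₂ (suc r , s<s r< , cong (λ k → suc (suc k)) eq)

-- Vertex 2r of T(n,2) is r ∈ ℤ/⌈n/2⌉ and vertex 2r+1 is r ∈ ℤ/⌊n/2⌋.
module TuránBipartition (n : ℕ) .{{_ : NonZero ⌈ n /2⌉}} .{{_ : NonZero ⌊ n /2⌋}} where

  even-index< : ∀ p → p % ⌈ n /2⌉ * 2 < n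
  even-index< p = m<⌈n/2⌉⇒m*2<n n (m%n<n p ⌈ n /2⌉)

  odd-index< : ∀ q → suc (q % ⌊ n /2⌋ * 2) < n
  odd-index< q = m<⌊n/2⌋⇒1+m*2<n n (m%n<n q ⌊ n /2⌋)

  even : ℕ → Fin n
  even p = fromℕ< (even-index< p)

  odd : ℕ → Fin n
  odd q = fromℕ< (odd-index< q)

  even-parity : ∀ p → toℕ (even p) % 2 ≡ 0
  even-parity p = trans (cong (_% 2) (toℕ-fromℕ< (even-index< p))) (m*n%n≡0 (p % ⌈ n /2⌉) 2)

  odd-parity : ∀ q → toℕ (odd q) % 2 ≡ 1
  odd-parity q = trans (cong (_% 2) (toℕ-fromℕ< (odd-index< q))) ([m+kn]%n≡m%n 1 (q % ⌊ n /2⌋) 2)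

  even-odd-adjacent : ∀ p q → TuranAdj n 2 (even p) (odd q)
  even-odd-adjacent p q eq = 0≢1+n (trans (sym (even-parity p)) (trans eq (odd-parity q)))

  isCompleteBipartite : IsCompleteBipartite n (TuranAdj n 2)
                          (Group.setoid (ℤmod.group ⌈ n /2⌉)) (Group.setoid (ℤmod.group ⌊ n /2⌋))
  isCompleteBipartite = record
    { left                    = even
    ; right                   = odd
    ; left-≡⇔≈                = λ p p′ → mk⇔
        (λ eq → *-cancelʳ-≡ _ _ 2 (fromℕ<-injective _ _ _ _ eq))
        (λ eq → fromℕ<-cong _ _ (cong (_* 2) eq) _ _)
    ; right-≡⇔≈               = λ q q′ → mk⇔
        (λ eq → *-cancelʳ-≡ _ _ 2 (suc-injective (fromℕ<-injective _ _ _ _ eq)))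
        (λ eq → fromℕ<-cong _ _ (cong (λ r → suc (r * 2)) eq) _ _)
    ; covers                  = covers
    ; left-right-adjacent     = even-odd-adjacent
    ; right-left-adjacent     = λ p q → even-odd-adjacent p q ∘ sym
    ; left-left-nonadjacent   = λ p p′ adj → adj (trans (even-parity p) (sym (even-parity p′)))
    ; right-right-nonadjacent = λ q q′ adj → adj (trans (odd-parity q) (sym (odd-parity q′)))
    }
    where
    covers : ∀ v → (∃ λ p → even p ≡ v) ⊎ (∃ λ q → odd q ≡ v)
    covers v with k<n⇒even⊎odd (toℕ<n v)
    ... | inj₁ (r , r< , eq) =
      inj₁ (r , toℕ-injective
        (trans (toℕ-fromℕ< (even-index< r)) (trans (cong (_* 2) (m<n⇒m%n≡m r<)) eq)))
    ... | inj₂ (r , r< , eq) =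
      inj₂ (r , toℕ-injective
        (trans (toℕ-fromℕ< (odd-index< r)) (trans (cong (λ r → suc (r * 2)) (m<n⇒m%n≡m r<)) eq)))

theorem6p3p5 : ∀ (n : ℕ) → n ≥ 2 → IsGGraph n (TuranAdj n 2)
theorem6p3p5 zero       ()
theorem6p3p5 (suc zero) (s≤s ())
theorem6p3p5 n@(suc (suc _)) _ =
  CyclicProduct.completeBipartite-isGGraph
    (ℤmod.group ⌈ n /2⌉) (ℤmod.group ⌊ n /2⌋) 1 1 (ℤmod.1-generates _) (ℤmod.1-generates _)
    (TuránBipartition.isCompleteBipartite n)
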